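{- Let $D$ be a directed graph and suppose $V(D)$ is partitioned into sets $A^+,A^-,R$ such that $E_D(R,A^+)=E_D(A^-,R)=E(D[A^+\cup A^-])=\emptyset$. Then: (a) if $\mathcal{P}=\{P_1,\dots,P_r\}$ is a partial decomposition of $D[R]$, then there is a partial decomposition $\mathcal{P}'=\{P'_1,\dots,P'_r\}$ of $D$ with $V(P'_i)\cap R=V(P_i)$ for all $i\in[r]$; (b) if $D[R]$ has a perfect decomposition then $D$ has a perfect decomposition; (c) if in addition $\mathrm{ex}_D(v)\ge 0$ for every $v\in N^+_D(A^+)$, $\mathrm{ex}_D(v)\le 0$ for every $v\in N^-_D(A^-)$, and $N^+_D(A^+)\cap N^-_D(A^-)=\emptyset$, then $\mathrm{ex}(D[R])=\mathrm{ex}(D)$.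
   Context: Paths are directed. $E_D(X,Y)$ is the set of edges of $D$ starting in $X$ and ending in $Y$; $D[X]$ is the induced subdigraph; $N^\pm_D(A)=\bigcup_{a\in A}N^\pm_D(a)$ (out-/in-neighbourhoods). For a digraph $D$, $\mathrm{ex}_D(v)=d^+_D(v)-d^-_D(v)$, $\mathrm{ex}^\pm_D(v)=\max\{\pm\mathrm{ex}_D(v),0\}$, $\mathrm{ex}(D)=\sum_v\mathrm{ex}^+_D(v)$. A partial decomposition of $D$ is a set of edge-disjoint paths of $D$ such that for every $v$ at most $\mathrm{ex}^+_D(v)$ of them start at $v$ and at most $\mathrm{ex}^-_D(v)$ end at $v$. A perfect decomposition of $D$ is a set of exactly $\mathrm{ex}(D)$ paths whose edge sets partition $E(D)$. -}

module Defs where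

open import Data.Nat using (ℕ; zero; suc; _+_; _∸_; _≤_)
open import Data.Integer as ℤ using (ℤ; +_; _-_)
open import Data.Fin using (Fin; _≟_)
open import Data.Bool using (Bool; true; false; if_then_else_; _∧_)
open import Data.List using (List; []; _∷_; map; allFin)
open import Data.Nat.ListAction using (sum)
open import Data.List.Relation.Unary.All using (All)
open import Data.List.Relation.Unary.Unique.Propositional using (Unique)
open import Data.List.Membership.Propositional using (_∈_)
open import Data.Product using (_×_; _,_; proj₁; proj₂; Σ; ∃)
open import Data.Empty using (⊥)
open import Relation.Nullary using (¬_)
open import Relation.Nullary.Decidable using (⌊_⌋)
open import Relation.Binary.PropositionalEquality using (_≡_; _≢_)
open import Function.Bundles using (_⇔_)

-- A digraph on vertex set Fin n, given by its adjacency relation: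
-- D u v ≡ true iff (u , v) is an edge.  (Simple digraph; 2-cycles allowed.)
Digraph : ℕ → Set
Digraph n = Fin n → Fin n → Bool

Loopless : ∀ {n} → Digraph n → Set
Loopless {n} D = (v : Fin n) → D v v ≡ false

Edge : ℕ → Set
Edge n = Fin n × Fin n

IsEdge : ∀ {n} → Digraph n → Edge n → Set
IsEdge D e = D (proj₁ e) (proj₂ e) ≡ true

countFin : ∀ {n} → (Fin n → Bool) → ℕ
countFin p = sum (map (λ w → if p w then 1 else 0) (allFin _))

outdeg indeg : ∀ {n} → Digraph n → Fin n → ℕ
outdeg D v = countFin (λ w → D v w)
indeg  D v = countFin (λ w → D w v)

ex : ∀ {n} → Digraph n → Fin n → ℤ
ex D v = + outdeg D v - + indeg D v

-- ex⁺_D(v) = max{ex_D(v),0},  ex⁻_D(v) = max{-ex_D(v),0}  (as naturals)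
ex⁺ ex⁻ : ∀ {n} → Digraph n → Fin n → ℕ
ex⁺ D v = outdeg D v ∸ indeg D v
ex⁻ D v = indeg D v ∸ outdeg D v

exTot : ∀ {n} → Digraph n → ℕ
exTot D = sum (map (ex⁺ D) (allFin _))

edgesOf : ∀ {n} → List (Fin n) → List (Edge n)
edgesOf [] = []
edgesOf (u ∷ []) = []
edgesOf (u ∷ v ∷ vs) = (u , v) ∷ edgesOf (v ∷ vs)

lastOf : ∀ {n} → Fin n → List (Fin n) → Fin n
lastOf u [] = u
lastOf u (v ∷ vs) = lastOf v vs

record Path {n} (D : Digraph n) : Set where
  field
    first : Fin n
    rest  : List (Fin n)
  verts : List (Fin n)
  verts = first ∷ rest
  field
    distinct : Unique verts
    adjacent : All (IsEdge D) (edgesOf verts)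
  pedges : List (Edge n)
  pedges = edgesOf verts
  start end : Fin n
  start = first
  end   = lastOf first rest

open Path public

EdgeDisjoint : ∀ {n} {D : Digraph n} {r} → (Fin r → Path D) → Set
EdgeDisjoint {n} {D} {r} P =
  (i j : Fin r) → i ≢ j → (e : Edge n) → e ∈ pedges (P i) → e ∈ pedges (P j) → ⊥

startsAt endsAt : ∀ {n} {D : Digraph n} {r} → (Fin r → Path D) → Fin n → ℕ
startsAt P v = countFin (λ i → ⌊ start (P i) ≟ v ⌋)
endsAt   P v = countFin (λ i → ⌊ end (P i) ≟ v ⌋)

PartialDecomp : ∀ {n} (D : Digraph n) {r} → (Fin r → Path D) → Set
PartialDecomp {n} D P =
  EdgeDisjoint P
  × ((v : Fin n) → startsAt P v ≤ ex⁺ D v)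
  × ((v : Fin n) → endsAt P v ≤ ex⁻ D v)

-- perfect decomposition: exactly ex(D) paths whose edge sets partition E(D)
-- (each path's edges lie in E(D) by definition of Path)
PerfectDecomp : ∀ {n} (D : Digraph n) → (Fin (exTot D) → Path D) → Set
PerfectDecomp {n} D P =
  EdgeDisjoint P
  × ((e : Edge n) → IsEdge D e → ∃ λ i → e ∈ pedges (P i))

HasPerfectDecomp : ∀ {n} → Digraph n → Set
HasPerfectDecomp D = Σ (Fin (exTot D) → Path D) (PerfectDecomp D)

data Part : Set where
  Aplus Aminus Rpart : Part

isR : Part → Bool
isR Rpart = true
isR _     = false

-- induced subdigraph D[R], realised on the same vertex set Fin n
-- (vertices outside R become isolated)
inducedR : ∀ {n} → Digraph n → (Fin n → Part) → Digraph n
inducedR D part u v = isR (part u) ∧ isR (part v) ∧ D u v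

-- Every edge of D outside D[R] leaves a vertex of A⁺, which has no in-edges, or enters a
-- vertex of A⁻, which has no out-edges.  So D is obtained from D[R] by adding the edges into R,
-- each leaving a source, and then the edges into A⁻, which in the reversed digraph leave
-- sources; reversing every edge and every path swaps starts with ends and ex⁺ with ex⁻.
-- Hence everything follows from one step: add an edge ab whose tail a has no in-edges.
-- If a path of the family starts at b, prepend a to it (a cannot lie on it); otherwise keep
-- the family.  A perfect decomposition has a path starting at b as soon as b has a surplus
-- (indeg < outdeg), and then ex is unchanged; if b has no surplus, ex grows by one and the
-- single edge ab is added as a new path.  The hypotheses of (c) give every head b of a new
-- edge a surplus at the moment ab is added, so ex never changes.

module Submission where

module PathDecompositions where

  open import Defs
  open import Data.Bool using (Bool; true; false; if_then_else_; _∧_; _∨_)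
  open import Data.Bool.Properties using (∨-zeroʳ)
  import Data.Integer as ℤ
  import Data.Integer.Properties as ℤ
  open import Data.Empty using (⊥; ⊥-elim)
  open import Data.Fin using (Fin; zero; suc; _≟_; punchIn)
  open import Data.Fin.Properties using (punchInᵢ≢i; any?; suc-injective)
  open import Data.List using (List; []; _∷_; map; allFin; tabulate; cartesianProduct)
  open import Data.List.Properties using (map-tabulate)
  open import Data.List.Membership.Propositional using (_∈_; _∉_)
  open import Data.List.Membership.Propositional.Properties using (∈-allFin; ∈-cartesianProduct⁺)
  open import Data.List.Relation.Unary.All as All using (All; []; _∷_)
  open import Data.List.Relation.Unary.AllPairs as AllPairs using ([]; _∷_)
  open import Data.List.Relation.Unary.Any using (here; there)
  import Data.List.Membership.DecPropositional as DecMembership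
  open import Data.List.Relation.Unary.Unique.Propositional using (Unique)
  open import Data.Nat as ℕ using (ℕ; zero; suc; _+_; _∸_; _≤_; _<_; z≤n; s≤s)
  import Data.Nat.ListAction as List
  import Data.Nat.Properties as ℕ
  open import Algebra.Properties.CommutativeMonoid.Sum ℕ.+-0-commutativeMonoid
    using (sum; sum-cong-≗; sum-remove; ∑-comm; ∑-distrib-+)
  open import Algebra.Properties.CommutativeSemigroup ℕ.+-commutativeSemigroup
    using (xy∙z≈xz∙y; xy∙z≈zy∙x)
  open import Data.Product.Properties using (≡-dec)
  open import Data.Product using (_×_; _,_; proj₁; proj₂; Σ; Σ-syntax; ∃-syntax)
  open import Data.Sum using (_⊎_; inj₁; inj₂; [_,_])
  open import Data.Vec.Functional using (removeAt; updateAt)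
  open import Data.Vec.Functional.Properties using (updateAt-updates; updateAt-minimal)
  open import Function using (_∘_; id; const; flip)
  open import Function.Bundles using (_⇔_; mk⇔; Equivalence)
  open import Relation.Binary.PropositionalEquality hiding ([_])
  open import Relation.Binary.Definitions using (DecidableEquality)
  open import Relation.Nullary using (¬_; yes; no; Dec)
  open import Relation.Nullary.Decidable using (⌊_⌋)

  ⌊⌋≡true⇒ : ∀ {A : Set} (d : Dec A) → ⌊ d ⌋ ≡ true → A
  ⌊⌋≡true⇒ (yes a) _ = a

  ⌊⌋≡true : ∀ {A : Set} (d : Dec A) → A → ⌊ d ⌋ ≡ true
  ⌊⌋≡true (yes _) _ = refl
  ⌊⌋≡true (no ¬a) a = ⊥-elim (¬a a)

  ⌊⌋≡false : ∀ {A : Set} (d : Dec A) → ¬ A → ⌊ d ⌋ ≡ false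
  ⌊⌋≡false (yes a) ¬a = ⊥-elim (¬a a)
  ⌊⌋≡false (no _)  _  = refl

  𝟙 : Bool → ℕ
  𝟙 b = if b then 1 else 0

  sum-tabulate : ∀ {n} (f : Fin n → ℕ) → List.sum (tabulate f) ≡ sum f
  sum-tabulate {zero}  f = refl
  sum-tabulate {suc n} f = cong (f zero +_) (sum-tabulate (f ∘ suc))

  sum-allFin : ∀ {n} (f : Fin n → ℕ) → List.sum (map f (allFin n)) ≡ sum f
  sum-allFin f = trans (cong List.sum (map-tabulate id f)) (sum-tabulate f)

  sum-mono-≤ : ∀ {n} {f g : Fin n → ℕ} → (∀ i → f i ≤ g i) → sum f ≤ sum g
  sum-mono-≤ {zero}  f≤g = z≤n
  sum-mono-≤ {suc n} f≤g = ℕ.+-mono-≤ (f≤g zero) (sum-mono-≤ (f≤g ∘ suc))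

  sum-mono-< : ∀ {n} {f g : Fin n → ℕ} → (∀ i → f i ≤ g i) → ∀ j → f j < g j → sum f < sum g
  sum-mono-< f≤g zero    fj<gj = ℕ.+-mono-<-≤ fj<gj (sum-mono-≤ (f≤g ∘ suc))
  sum-mono-< f≤g (suc j) fj<gj = ℕ.+-mono-≤-< (f≤g zero) (sum-mono-< (f≤g ∘ suc) j fj<gj)

  term≤sum : ∀ {n} (f : Fin n → ℕ) j → f j ≤ sum f
  term≤sum f zero    = ℕ.m≤m+n _ _
  term≤sum f (suc j) = ℕ.≤-trans (term≤sum (f ∘ suc) j) (ℕ.m≤n+m _ _)

  sum-update : ∀ {n} {f g : Fin n → ℕ} j → (∀ i → i ≢ j → f i ≡ g i) → sum f + g j ≡ sum g + f j
  sum-update {suc n} {f} {g} j agree = begin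
    sum f + g j                    ≡⟨ cong (_+ g j) (sum-remove {i = j} f) ⟩
    f j + sum (removeAt f j) + g j ≡⟨ cong (λ s → f j + s + g j) (sum-cong-≗ agree′) ⟩
    f j + sum (removeAt g j) + g j ≡⟨ xy∙z≈zy∙x (f j) _ (g j) ⟩
    g j + sum (removeAt g j) + f j ≡⟨ cong (_+ f j) (sum-remove {i = j} g) ⟨
    sum g + f j                    ∎
    where
    open ≡-Reasoning
    agree′ : ∀ i → removeAt f j i ≡ removeAt g j i
    agree′ i = agree (punchIn j i) (punchInᵢ≢i j i)

  sum-update₂ : ∀ {n} {f g : Fin n → ℕ} j k → j ≢ k → (∀ i → i ≢ j → i ≢ k → f i ≡ g i) →
                sum f + g j + g k ≡ sum g + f j + f k
  sum-update₂ {f = f} {g} j k j≢k agree = begin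
    sum f + g j + g k     ≡⟨ cong (_+ g k) (trans (cong (sum f +_) (sym mid-j)) (sum-update j f≗mid)) ⟩
    sum mid + f j + g k   ≡⟨ xy∙z≈xz∙y (sum mid) (f j) (g k) ⟩
    sum mid + g k + f j   ≡⟨ cong (_+ f j) (trans (sum-update k mid≗g) (cong (sum g +_) mid-k)) ⟩
    sum g + f k + f j     ≡⟨ xy∙z≈xz∙y (sum g) (f k) (f j) ⟩
    sum g + f j + f k     ∎
    where
    open ≡-Reasoning
    mid : Fin _ → ℕ
    mid = updateAt f j (const (g j))
    mid-j : mid j ≡ g j
    mid-j = updateAt-updates j f
    mid-k : mid k ≡ f k
    mid-k = updateAt-minimal k j f (j≢k ∘ sym)
    f≗mid : ∀ i → i ≢ j → f i ≡ mid i
    f≗mid i i≢j = sym (updateAt-minimal i j f i≢j)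
    mid≗g : ∀ i → i ≢ k → mid i ≡ g i
    mid≗g i i≢k with i ≟ j
    ... | yes refl = mid-j
    ... | no  i≢j  = trans (updateAt-minimal i j f i≢j) (agree i i≢j i≢k)

  sum-zero : ∀ {n} {f : Fin n → ℕ} → (∀ i → f i ≡ 0) → sum f ≡ 0
  sum-zero {zero}  f≡0 = refl
  sum-zero {suc n} f≡0 = cong₂ _+_ (f≡0 zero) (sum-zero (f≡0 ∘ suc))

  sum-pos : ∀ {n} (f : Fin n → ℕ) → 0 < sum f → ∃[ i ] 0 < f i
  sum-pos {suc n} f 0<sum with f zero in eq
  ... | suc _ = zero , subst (0 <_) (sym eq) (s≤s z≤n)
  ... | zero  = let i , 0<fi = sum-pos (f ∘ suc) 0<sum in suc i , 0<fi

  𝟙-mono : ∀ {b c} → (b ≡ true → c ≡ true) → 𝟙 b ≤ 𝟙 c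
  𝟙-mono {false} b⇒c = z≤n
  𝟙-mono {true}  b⇒c rewrite b⇒c refl = ℕ.≤-refl

  module _ {n : ℕ} where

    countFin-sum : (p : Fin n → Bool) → countFin p ≡ sum (𝟙 ∘ p)
    countFin-sum p = sum-allFin (𝟙 ∘ p)

    countFin-cong : {p q : Fin n → Bool} → (∀ i → p i ≡ q i) → countFin p ≡ countFin q
    countFin-cong {p} {q} p≗q = begin
      countFin p       ≡⟨ countFin-sum p ⟩
      sum (𝟙 ∘ p)      ≡⟨ sum-cong-≗ (cong 𝟙 ∘ p≗q) ⟩
      sum (𝟙 ∘ q)      ≡⟨ countFin-sum q ⟨
      countFin q       ∎
      where open ≡-Reasoning

    countFin-mono : {p q : Fin n → Bool} → (∀ i → p i ≡ true → q i ≡ true) → countFin p ≤ countFin q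
    countFin-mono {p} {q} p⊆q = begin
      countFin p       ≡⟨ countFin-sum p ⟩
      sum (𝟙 ∘ p)      ≤⟨ sum-mono-≤ (𝟙-mono ∘ p⊆q) ⟩
      sum (𝟙 ∘ q)      ≡⟨ countFin-sum q ⟨
      countFin q       ∎
      where open ℕ.≤-Reasoning

    countFin-mono-< : {p q : Fin n → Bool} → (∀ i → p i ≡ true → q i ≡ true) →
                      ∀ j → p j ≡ false → q j ≡ true → countFin p < countFin q
    countFin-mono-< {p} {q} p⊆q j pj qj = begin-strict
      countFin p       ≡⟨ countFin-sum p ⟩
      sum (𝟙 ∘ p)      <⟨ sum-mono-< (𝟙-mono ∘ p⊆q) j 𝟙pj<𝟙qj ⟩
      sum (𝟙 ∘ q)      ≡⟨ countFin-sum q ⟨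
      countFin q       ∎
      where
      open ℕ.≤-Reasoning
      𝟙pj<𝟙qj : 𝟙 (p j) < 𝟙 (q j)
      𝟙pj<𝟙qj rewrite pj | qj = s≤s z≤n

    countFin-update : {p q : Fin n → Bool} (j : Fin n) → (∀ i → i ≢ j → p i ≡ q i) →
                      countFin p + 𝟙 (q j) ≡ countFin q + 𝟙 (p j)
    countFin-update {p} {q} j agree = begin
      countFin p + 𝟙 (q j)   ≡⟨ cong (_+ 𝟙 (q j)) (countFin-sum p) ⟩
      sum (𝟙 ∘ p) + 𝟙 (q j)  ≡⟨ sum-update j (λ i i≢j → cong 𝟙 (agree i i≢j)) ⟩
      sum (𝟙 ∘ q) + 𝟙 (p j)  ≡⟨ cong (_+ 𝟙 (p j)) (countFin-sum q) ⟨
      countFin q + 𝟙 (p j)   ∎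
      where open ≡-Reasoning

    countFin-zero : {p : Fin n → Bool} → (∀ i → p i ≡ false) → countFin p ≡ 0
    countFin-zero {p} none = trans (countFin-sum p) (sum-zero (cong 𝟙 ∘ none))

    countFin-pos : (p : Fin n → Bool) → 0 < countFin p → ∃[ i ] p i ≡ true
    countFin-pos p 0<count with sum-pos (𝟙 ∘ p) (subst (0 <_) (countFin-sum p) 0<count)
    ... | i , 0<𝟙 with p i in pi
    ...   | true = i , pi

    countFin-witness : (p : Fin n → Bool) (j : Fin n) → p j ≡ true → 0 < countFin p
    countFin-witness p j pj = subst (0 <_) (sym (countFin-sum p))
      (ℕ.≤-trans (ℕ.≤-reflexive (cong 𝟙 (sym pj))) (term≤sum (𝟙 ∘ p) j))

    countFin≤1 : (p : Fin n → Bool) → (∀ i j → p i ≡ true → p j ≡ true → i ≡ j) → countFin p ≤ 1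
    countFin≤1 p unique = subst (_≤ 1) (sym (countFin-sum p)) (sum-𝟙≤1 p unique)
      where
      sum-𝟙≤1 : ∀ {m} (q : Fin m → Bool) → (∀ i j → q i ≡ true → q j ≡ true → i ≡ j) →
                sum (𝟙 ∘ q) ≤ 1
      sum-𝟙≤1 {zero}  q unique = z≤n
      sum-𝟙≤1 {suc m} q unique with q zero in q0
      ... | false = sum-𝟙≤1 (q ∘ suc) (λ i j qi qj → suc-injective (unique (suc i) (suc j) qi qj))
      ... | true  = ℕ.≤-reflexive (cong suc (sum-zero (cong 𝟙 ∘ others-false)))
        where
        others-false : ∀ i → q (suc i) ≡ false
        others-false i with q (suc i) in qi
        ... | false = refl
        ... | true  with () ← unique zero (suc i) q0 qi

  countFin-comm : ∀ {m n} (M : Fin n → Fin m → Bool) →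
                  sum (λ i → countFin (M i)) ≡ sum (λ j → countFin (λ i → M i j))
  countFin-comm M = begin
    sum (λ i → countFin (M i))             ≡⟨ sum-cong-≗ (λ i → countFin-sum (M i)) ⟩
    sum (λ i → sum (λ j → 𝟙 (M i j)))      ≡⟨ ∑-comm (λ i j → 𝟙 (M i j)) ⟩
    sum (λ j → sum (λ i → 𝟙 (M i j)))      ≡⟨ sum-cong-≗ (λ j → countFin-sum (λ i → M i j)) ⟨
    sum (λ j → countFin (λ i → M i j))     ∎
    where open ≡-Reasoning

  infix 4 _⊆_ _≐_

  _⊆_ : ∀ {n} → Digraph n → Digraph n → Set
  G ⊆ H = ∀ {x y} → G x y ≡ true → H x y ≡ true

  _≐_ : ∀ {n} → Digraph n → Digraph n → Set
  G ≐ H = ∀ x y → G x y ≡ H x y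

  module _ {n : ℕ} where

    edgesOf-tail∈ : ∀ {x y : Fin n} u vs → (x , y) ∈ edgesOf (u ∷ vs) → x ∈ u ∷ vs
    edgesOf-tail∈ u (v ∷ vs) (here refl) = here refl
    edgesOf-tail∈ u (v ∷ vs) (there e)   = there (edgesOf-tail∈ v vs e)

    edgesOf-successor-unique : ∀ {x y y′ : Fin n} u vs → Unique (u ∷ vs) →
                               (x , y) ∈ edgesOf (u ∷ vs) → (x , y′) ∈ edgesOf (u ∷ vs) → y ≡ y′
    edgesOf-successor-unique u (v ∷ vs) _          (here refl) (here refl) = refl
    edgesOf-successor-unique u (v ∷ vs) (u∉ ∷ _)   (here refl) (there e)   =
      ⊥-elim (All.lookup u∉ (edgesOf-tail∈ v vs e) refl)
    edgesOf-successor-unique u (v ∷ vs) (u∉ ∷ _)   (there e)   (here refl) =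
      ⊥-elim (All.lookup u∉ (edgesOf-tail∈ v vs e) refl)
    edgesOf-successor-unique u (v ∷ vs) (_ ∷ uniq) (there e)   (there e′)  = edgesOf-successor-unique v vs uniq e e′

    edgesOf-predecessor : ∀ {x : Fin n} u vs → x ∈ u ∷ vs → x ≢ u → ∃[ w ] (w , x) ∈ edgesOf (u ∷ vs)
    edgesOf-predecessor u vs (here refl) x≢u = ⊥-elim (x≢u refl)
    edgesOf-predecessor {x} u (v ∷ vs) (there x∈) _ with x ≟ v
    ... | yes refl = u , here refl
    ... | no  x≢v  = let w , e = edgesOf-predecessor v vs x∈ x≢v in w , there e

  module _ {n : ℕ} {H : Digraph n} where

    ∈-pedges⇒IsEdge : ∀ (Q : Path H) {e} → e ∈ pedges Q → IsEdge H e
    ∈-pedges⇒IsEdge Q = All.lookup (adjacent Q)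

    ∈-pedges⇒∈-verts : ∀ (Q : Path H) {x y} → (x , y) ∈ pedges Q → x ∈ verts Q
    ∈-pedges⇒∈-verts Q = edgesOf-tail∈ (first Q) (rest Q)

    predecessor : ∀ (Q : Path H) {x} → x ∈ verts Q → x ≢ start Q → ∃[ w ] (w , x) ∈ pedges Q
    predecessor Q = edgesOf-predecessor (first Q) (rest Q)

    source∈verts⇒start : ∀ (Q : Path H) {x} → (∀ w → H w x ≡ false) → x ∈ verts Q → x ≡ start Q
    source∈verts⇒start Q {x} no-in x∈ with x ≟ start Q
    ... | yes x≡start = x≡start
    ... | no  x≢start with predecessor Q x∈ x≢start
    ...   | w , e with () ← trans (sym (no-in w)) (∈-pedges⇒IsEdge Q e)

    trivialPath : Fin n → Path H
    trivialPath x = record { first = x ; rest = [] ; distinct = [] ∷ [] ; adjacent = [] }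

    edgePath : ∀ {u v} → u ≢ v → H u v ≡ true → Path H
    edgePath {u} {v} u≢v uv = record
      { first = u ; rest = v ∷ [] ; distinct = (u≢v ∷ []) ∷ ([] ∷ []) ; adjacent = uv ∷ [] }

    prepend : (u : Fin n) (Q : Path H) → u ∉ verts Q → H u (start Q) ≡ true → Path H
    prepend u Q u∉Q edge = record
      { first    = u
      ; rest     = verts Q
      ; distinct = All.tabulate (λ x∈Q u≡x → u∉Q (subst (_∈ verts Q) (sym u≡x) x∈Q)) ∷ distinct Q
      ; adjacent = edge ∷ adjacent Q
      }

  liftPath : ∀ {n} {G H : Digraph n} → G ⊆ H → Path G → Path H
  liftPath G⊆H Q = record
    { first = first Q ; rest = rest Q ; distinct = distinct Q ; adjacent = All.map G⊆H (adjacent Q) }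

  module _ {n : ℕ} {H : Digraph n} where

    -- The path with vertex list  reverse ys ++ verts Q.
    reverseOnto : (Q : Path (flip H)) (ys : List (Fin n)) → All (_∉ verts Q) ys → Unique ys →
                  All (IsEdge H) (edgesOf (start Q ∷ ys)) → Path (flip H)
    reverseOnto Q []       _             _             _        = Q
    reverseOnto Q (y ∷ ys) (y∉Q ∷ ys∉Q) (y≢ys ∷ ys!) (e ∷ es) =
      reverseOnto (prepend y Q y∉Q e) ys (All.zipWith ∉-cons (y≢ys , ys∉Q)) ys! es
      where
      ∉-cons : ∀ {z} → y ≢ z × z ∉ verts Q → z ∉ y ∷ verts Q
      ∉-cons (y≢z , z∉Q) (here z≡y) = y≢z (sym z≡y)
      ∉-cons (y≢z , z∉Q) (there z∈Q) = z∉Q z∈Q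

    reverseOnto-start : ∀ Q ys ys∉Q ys! es → start (reverseOnto Q ys ys∉Q ys! es) ≡ lastOf (start Q) ys
    reverseOnto-start Q []       _       _       _        = refl
    reverseOnto-start Q (y ∷ ys) (_ ∷ _) (_ ∷ _) (_ ∷ _) = reverseOnto-start _ ys _ _ _

    reverseOnto-end : ∀ Q ys ys∉Q ys! es → end (reverseOnto Q ys ys∉Q ys! es) ≡ end Q
    reverseOnto-end Q []       _       _       _        = refl
    reverseOnto-end Q (y ∷ ys) (_ ∷ _) (_ ∷ _) (_ ∷ _) = reverseOnto-end _ ys _ _ _

    ∈-verts-reverseOnto⁻ : ∀ Q ys ys∉Q ys! es {x} → x ∈ verts (reverseOnto Q ys ys∉Q ys! es) →
                           x ∈ verts Q ⊎ x ∈ ys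
    ∈-verts-reverseOnto⁻ Q []       _       _       _       x∈ = inj₁ x∈
    ∈-verts-reverseOnto⁻ Q (y ∷ ys) (_ ∷ _) (_ ∷ _) (_ ∷ _) x∈ with ∈-verts-reverseOnto⁻ _ ys _ _ _ x∈
    ... | inj₁ (here x≡y)  = inj₂ (here x≡y)
    ... | inj₁ (there x∈Q) = inj₁ x∈Q
    ... | inj₂ x∈ys        = inj₂ (there x∈ys)

    ∈-verts-reverseOnto⁺ : ∀ Q ys ys∉Q ys! es {x} → x ∈ verts Q ⊎ x ∈ ys →
                           x ∈ verts (reverseOnto Q ys ys∉Q ys! es)
    ∈-verts-reverseOnto⁺ Q []       _       _       _       (inj₁ x∈Q) = x∈Q
    ∈-verts-reverseOnto⁺ Q (y ∷ ys) (_ ∷ _) (_ ∷ _) (_ ∷ _) x∈ = ∈-verts-reverseOnto⁺ _ ys _ _ _ (shift x∈)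
      where
      shift : ∀ {x} → x ∈ verts Q ⊎ x ∈ y ∷ ys → x ∈ y ∷ verts Q ⊎ x ∈ ys
      shift (inj₁ x∈Q)         = inj₁ (there x∈Q)
      shift (inj₂ (here x≡y))  = inj₁ (here x≡y)
      shift (inj₂ (there x∈ys)) = inj₂ x∈ys

    ∈-pedges-reverseOnto⁻ : ∀ Q ys ys∉Q ys! es {x z} → (x , z) ∈ pedges (reverseOnto Q ys ys∉Q ys! es) →
                            (x , z) ∈ pedges Q ⊎ (z , x) ∈ edgesOf (start Q ∷ ys)
    ∈-pedges-reverseOnto⁻ Q []       _       _       _       e = inj₁ e
    ∈-pedges-reverseOnto⁻ Q (y ∷ ys) (_ ∷ _) (_ ∷ _) (_ ∷ _) e with ∈-pedges-reverseOnto⁻ _ ys _ _ _ e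
    ... | inj₁ (here refl) = inj₂ (here refl)
    ... | inj₁ (there e∈Q) = inj₁ e∈Q
    ... | inj₂ e∈ys        = inj₂ (there e∈ys)

    ∈-pedges-reverseOnto⁺ : ∀ Q ys ys∉Q ys! es {x z} → (x , z) ∈ pedges Q ⊎ (z , x) ∈ edgesOf (start Q ∷ ys) →
                            (x , z) ∈ pedges (reverseOnto Q ys ys∉Q ys! es)
    ∈-pedges-reverseOnto⁺ Q []       _       _       _       (inj₁ e∈Q) = e∈Q
    ∈-pedges-reverseOnto⁺ Q (y ∷ ys) (_ ∷ _) (_ ∷ _) (_ ∷ _) e = ∈-pedges-reverseOnto⁺ _ ys _ _ _ (shift e)
      where
      shift : ∀ {x z} → (x , z) ∈ pedges Q ⊎ (z , x) ∈ edgesOf (start Q ∷ y ∷ ys) →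
              (x , z) ∈ (y , start Q) ∷ pedges Q ⊎ (z , x) ∈ edgesOf (y ∷ ys)
      shift (inj₁ e∈Q)         = inj₁ (there e∈Q)
      shift (inj₂ (here refl)) = inj₁ (here refl)
      shift (inj₂ (there e))   = inj₂ e

    reversePath : Path H → Path (flip H)
    reversePath P = reverseOnto (trivialPath (first P)) (rest P) first∉ (AllPairs.tail (distinct P)) (adjacent P)
      where
      first∉ : All (_∉ first P ∷ []) (rest P)
      first∉ = All.map (λ { first≢x (here x≡first) → first≢x (sym x≡first) }) (AllPairs.head (distinct P))

    reversePath-start : ∀ P → start (reversePath P) ≡ end P
    reversePath-start P = reverseOnto-start (trivialPath (first P)) (rest P) _ _ _

    reversePath-end : ∀ P → end (reversePath P) ≡ start P
    reversePath-end P = reverseOnto-end (trivialPath (first P)) (rest P) _ _ _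

    ∈-verts-reversePath : ∀ P {x} → x ∈ verts (reversePath P) ⇔ x ∈ verts P
    ∈-verts-reversePath P = mk⇔ (merge ∘ ∈-verts-reverseOnto⁻ (trivialPath (first P)) (rest P) _ _ _)
                                (∈-verts-reverseOnto⁺ (trivialPath (first P)) (rest P) _ _ _ ∘ split)
      where
      merge : ∀ {x} → x ∈ first P ∷ [] ⊎ x ∈ rest P → x ∈ verts P
      merge (inj₁ (here x≡first)) = here x≡first
      merge (inj₂ x∈rest)         = there x∈rest
      split : ∀ {x} → x ∈ verts P → x ∈ first P ∷ [] ⊎ x ∈ rest P
      split (here x≡first) = inj₁ (here x≡first)
      split (there x∈rest) = inj₂ x∈rest

    ∈-pedges-reversePath : ∀ P {x z} → (x , z) ∈ pedges (reversePath P) ⇔ (z , x) ∈ pedges P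
    ∈-pedges-reversePath P = mk⇔ (drop-trivial ∘ ∈-pedges-reverseOnto⁻ (trivialPath (first P)) (rest P) _ _ _)
                                 (∈-pedges-reverseOnto⁺ (trivialPath (first P)) (rest P) _ _ _ ∘ inj₂)
      where
      drop-trivial : ∀ {x z} → (x , z) ∈ [] ⊎ (z , x) ∈ pedges P → (z , x) ∈ pedges P
      drop-trivial (inj₂ e) = e

  Covers : ∀ {n} {H : Digraph n} {r} → (Fin r → Path H) → Set
  Covers {n} {H} P = (e : Edge n) → IsEdge H e → ∃[ i ] e ∈ pedges (P i)

  _≟ᴱ_ : ∀ {n} → DecidableEquality (Edge n)
  _≟ᴱ_ = ≡-dec _≟_ _≟_

  module _ {n : ℕ} where

    open DecMembership (_≟ᴱ_ {n}) using (_∈?_)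

    _∈ᵇ_ : Edge n → List (Edge n) → Bool
    e ∈ᵇ es = ⌊ e ∈? es ⌋

    ∈ᵇ⇒∈ : ∀ {e es} → e ∈ᵇ es ≡ true → e ∈ es
    ∈ᵇ⇒∈ {e} {es} = ⌊⌋≡true⇒ (e ∈? es)

    ∈⇒∈ᵇ : ∀ {e es} → e ∈ es → e ∈ᵇ es ≡ true
    ∈⇒∈ᵇ {e} {es} = ⌊⌋≡true (e ∈? es)

    ∉⇒∈ᵇ : ∀ {e es} → e ∉ es → e ∈ᵇ es ≡ false
    ∉⇒∈ᵇ {e} {es} = ⌊⌋≡false (e ∈? es)

  module _ {n : ℕ} {H : Digraph n} where

    outEdges inEdges : Path H → Fin n → ℕ
    outEdges Q v = countFin (λ w → (v , w) ∈ᵇ pedges Q)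
    inEdges  Q v = countFin (λ w → (w , v) ∈ᵇ pedges Q)

    outEdges≤inEdges : ∀ (Q : Path H) {v} → start Q ≢ v → outEdges Q v ≤ inEdges Q v
    outEdges≤inEdges Q {v} start≢v = at-most-one⇒≤ out≤1 out>0⇒in≥1
      where
      at-most-one⇒≤ : ∀ {m k} → m ≤ 1 → (0 < m → 1 ≤ k) → m ≤ k
      at-most-one⇒≤ z≤n       _ = z≤n
      at-most-one⇒≤ (s≤s z≤n) f = f (s≤s z≤n)
      out≤1 : outEdges Q v ≤ 1
      out≤1 = countFin≤1 (λ w → (v , w) ∈ᵇ pedges Q) (λ w w′ e e′ →
                edgesOf-successor-unique (first Q) (rest Q) (distinct Q) (∈ᵇ⇒∈ e) (∈ᵇ⇒∈ e′))
      out>0⇒in≥1 : 0 < outEdges Q v → 1 ≤ inEdges Q v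
      out>0⇒in≥1 out>0 =
        let w , v→w = countFin-pos (λ w → (v , w) ∈ᵇ pedges Q) out>0
            x , x→v = predecessor Q (∈-pedges⇒∈-verts Q (∈ᵇ⇒∈ v→w)) (start≢v ∘ sym)
        in countFin-witness (λ w → (w , v) ∈ᵇ pedges Q) x (∈⇒∈ᵇ x→v)

  module _ {n : ℕ} {H : Digraph n} {r} (P : Fin r → Path H) (disjoint : EdgeDisjoint P) (covers : Covers P) where

    users : Fin n → Fin n → ℕ
    users x y = countFin (λ i → (x , y) ∈ᵇ pedges (P i))

    edge≤users : ∀ x y → 𝟙 (H x y) ≤ users x y
    edge≤users x y with H x y in xy
    ... | false = z≤n
    ... | true  = let i , xy∈Pi = covers (x , y) xy
                  in countFin-witness (λ i → (x , y) ∈ᵇ pedges (P i)) i (∈⇒∈ᵇ xy∈Pi)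

    users≤edge : ∀ x y → users x y ≤ 𝟙 (H x y)
    users≤edge x y with H x y in xy
    ... | true  = countFin≤1 (λ i → (x , y) ∈ᵇ pedges (P i)) same-path
      where
      same-path : ∀ i j → (x , y) ∈ᵇ pedges (P i) ≡ true → (x , y) ∈ᵇ pedges (P j) ≡ true → i ≡ j
      same-path i j xy∈Pi xy∈Pj with i ≟ j
      ... | yes i≡j = i≡j
      ... | no  i≢j = ⊥-elim (disjoint i j i≢j (x , y) (∈ᵇ⇒∈ xy∈Pi) (∈ᵇ⇒∈ xy∈Pj))
    ... | false = ℕ.≤-reflexive (countFin-zero (λ i → ∉⇒∈ᵇ (not-an-edge i)))
      where
      not-an-edge : ∀ i → (x , y) ∉ pedges (P i)
      not-an-edge i xy∈Pi with () ← trans (sym xy) (∈-pedges⇒IsEdge (P i) xy∈Pi)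

    no-start⇒outdeg≤indeg : ∀ {v} → (∀ i → start (P i) ≢ v) → outdeg H v ≤ indeg H v
    no-start⇒outdeg≤indeg {v} no-start = begin
      outdeg H v                           ≡⟨ countFin-sum (H v) ⟩
      sum (λ w → 𝟙 (H v w))                ≤⟨ sum-mono-≤ (edge≤users v) ⟩
      sum (λ w → users v w)                ≡⟨ countFin-comm (λ i w → (v , w) ∈ᵇ pedges (P i)) ⟨
      sum (λ i → outEdges (P i) v)         ≤⟨ sum-mono-≤ (λ i → outEdges≤inEdges (P i) (no-start i)) ⟩
      sum (λ i → inEdges (P i) v)          ≡⟨ countFin-comm (λ i x → (x , v) ∈ᵇ pedges (P i)) ⟩
      sum (λ x → users x v)                ≤⟨ sum-mono-≤ (λ x → users≤edge x v) ⟩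
      sum (λ x → 𝟙 (H x v))                ≡⟨ countFin-sum (λ x → H x v) ⟨
      indeg H v                            ∎
      where open ℕ.≤-Reasoning

    surplus⇒start : ∀ {v} → indeg H v < outdeg H v → ∃[ i ] start (P i) ≡ v
    surplus⇒start {v} surplus with any? (λ i → start (P i) ≟ v)
    ... | yes found = found
    ... | no  none  = ⊥-elim (ℕ.<⇒≱ surplus (no-start⇒outdeg≤indeg (λ i start≡v → none (i , start≡v))))

  exTot-sum : ∀ {n} (H : Digraph n) → exTot H ≡ sum (ex⁺ H)
  exTot-sum H = sum-allFin (ex⁺ H)

  𝟙-≟-refl : ∀ {n} (x : Fin n) → 𝟙 ⌊ x ≟ x ⌋ ≡ 1
  𝟙-≟-refl x = cong 𝟙 (⌊⌋≡true (x ≟ x) refl)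

  𝟙-≟-≢ : ∀ {n} {x y : Fin n} → x ≢ y → 𝟙 ⌊ x ≟ y ⌋ ≡ 0
  𝟙-≟-≢ {x = x} {y} x≢y = cong 𝟙 (⌊⌋≡false (x ≟ y) x≢y)

  ExtendsBy : ∀ {n} {G H : Digraph n} {r} → (Fin r → Path H) → (Fin r → Path G) → (Fin n → Set) → Set
  ExtendsBy {n} P′ P Z =
    ∀ i {x : Fin n} → (x ∈ verts (P i) → x ∈ verts (P′ i)) × (x ∈ verts (P′ i) → x ∈ verts (P i) ⊎ Z x)

  mkPerfectDecomp : ∀ {n} {H : Digraph n} {k} → k ≡ exTot H → (P : Fin k → Path H) →
                    EdgeDisjoint P → Covers P → HasPerfectDecomp H
  mkPerfectDecomp refl P disjoint covers = P , disjoint , covers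

  record SourceEdgeAddition {n} (H₀ : Digraph n) (a b : Fin n) (H : Digraph n) : Set where
    field
      absent  : H₀ a b ≡ false
      present : H a b ≡ true
      agree   : ∀ {x y} → (x , y) ≢ (a , b) → H x y ≡ H₀ x y
      source  : ∀ x → H x a ≡ false

  module SourceEdgeStep {n} {H₀ H : Digraph n} {a b : Fin n} (step : SourceEdgeAddition H₀ a b H) where

    open SourceEdgeAddition step

    a≢b : a ≢ b
    a≢b refl with () ← trans (sym (source a)) present

    H₀⊆H : H₀ ⊆ H
    H₀⊆H {x} {y} xy with (x , y) ≟ᴱ (a , b)
    ... | yes refl with () ← trans (sym absent) xy
    ... | no  xy≢ab = trans (agree xy≢ab) xy

    new-or-old : ∀ {x y} → H x y ≡ true → (x , y) ≡ (a , b) ⊎ H₀ x y ≡ true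
    new-or-old {x} {y} xy with (x , y) ≟ᴱ (a , b)
    ... | yes xy≡ab = inj₁ xy≡ab
    ... | no  xy≢ab = inj₂ (trans (sym (agree xy≢ab)) xy)

    source₀ : ∀ x → H₀ x a ≡ false
    source₀ x = trans (sym (agree (a≢b ∘ cong proj₂))) (source x)

    ab∉ : ∀ (Q : Path H₀) → (a , b) ∉ pedges Q
    ab∉ Q ab∈Q with () ← trans (sym absent) (∈-pedges⇒IsEdge Q ab∈Q)

    outdeg-a : outdeg H a ≡ suc (outdeg H₀ a)
    outdeg-a = begin
      outdeg H a                ≡⟨ ℕ.+-identityʳ _ ⟨
      outdeg H a + 0            ≡⟨ cong (outdeg H a +_) (cong 𝟙 absent) ⟨
      outdeg H a + 𝟙 (H₀ a b)   ≡⟨ countFin-update b (λ w w≢b → agree (w≢b ∘ cong proj₂)) ⟩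
      outdeg H₀ a + 𝟙 (H a b)   ≡⟨ cong (outdeg H₀ a +_) (cong 𝟙 present) ⟩
      outdeg H₀ a + 1           ≡⟨ ℕ.+-comm (outdeg H₀ a) 1 ⟩
      suc (outdeg H₀ a)         ∎
      where open ≡-Reasoning

    indeg-b : indeg H b ≡ suc (indeg H₀ b)
    indeg-b = begin
      indeg H b                 ≡⟨ ℕ.+-identityʳ _ ⟨
      indeg H b + 0             ≡⟨ cong (indeg H b +_) (cong 𝟙 absent) ⟨
      indeg H b + 𝟙 (H₀ a b)    ≡⟨ countFin-update a (λ w w≢a → agree (w≢a ∘ cong proj₁)) ⟩
      indeg H₀ b + 𝟙 (H a b)    ≡⟨ cong (indeg H₀ b +_) (cong 𝟙 present) ⟩
      indeg H₀ b + 1            ≡⟨ ℕ.+-comm (indeg H₀ b) 1 ⟩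
      suc (indeg H₀ b)          ∎
      where open ≡-Reasoning

    outdeg-other : ∀ {x} → x ≢ a → outdeg H x ≡ outdeg H₀ x
    outdeg-other {x} x≢a = countFin-cong {p = H x} (λ w → agree (x≢a ∘ cong proj₁))

    indeg-other : ∀ {x} → x ≢ b → indeg H x ≡ indeg H₀ x
    indeg-other {x} x≢b = countFin-cong {p = λ w → H w x} (λ w → agree (x≢b ∘ cong proj₂))

    indeg-a : indeg H a ≡ 0
    indeg-a = countFin-zero source

    indeg₀-a : indeg H₀ a ≡ 0
    indeg₀-a = trans (sym (indeg-other a≢b)) indeg-a

    ex⁺-a : ex⁺ H a ≡ suc (ex⁺ H₀ a)
    ex⁺-a rewrite outdeg-a | indeg-a | indeg₀-a = refl

    ex⁺-b : ex⁺ H b ≡ ℕ.pred (ex⁺ H₀ b)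
    ex⁺-b rewrite outdeg-other (a≢b ∘ sym) | indeg-b = sym (ℕ.pred[m∸n]≡m∸[1+n] (outdeg H₀ b) (indeg H₀ b))

    ex⁺-other : ∀ {x} → x ≢ a → x ≢ b → ex⁺ H x ≡ ex⁺ H₀ x
    ex⁺-other x≢a x≢b = cong₂ _∸_ (outdeg-other x≢a) (indeg-other x≢b)

    ex⁺-mono : ∀ {x} → x ≢ b → ex⁺ H₀ x ≤ ex⁺ H x
    ex⁺-mono {x} x≢b rewrite indeg-other x≢b =
      ℕ.∸-monoˡ-≤ (indeg H₀ x) (countFin-mono {p = H₀ x} (λ _ → H₀⊆H))

    ex⁻₀-a : ex⁻ H₀ a ≡ 0
    ex⁻₀-a = trans (cong (_∸ outdeg H₀ a) indeg₀-a) (ℕ.0∸n≡0 (outdeg H₀ a))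

    ex⁻-bound : ∀ {m} x → m ≤ ex⁻ H₀ x → m ≤ ex⁻ H x
    ex⁻-bound {m} x m≤ with x ≟ a
    ... | yes refl = ℕ.≤-trans (subst (m ≤_) ex⁻₀-a m≤) z≤n
    ... | no  x≢a rewrite outdeg-other x≢a =
      ℕ.≤-trans m≤ (ℕ.∸-monoˡ-≤ (outdeg H₀ x) (countFin-mono {p = λ w → H₀ w x} (λ _ → H₀⊆H)))

    exTot-step : exTot H + ex⁺ H₀ b ≡ suc (exTot H₀ + ℕ.pred (ex⁺ H₀ b))
    exTot-step = ℕ.+-cancelʳ-≡ (ex⁺ H₀ a) _ _ (begin
      exTot H + ex⁺ H₀ b + ex⁺ H₀ a                  ≡⟨ xy∙z≈xz∙y (exTot H) _ _ ⟩
      exTot H + ex⁺ H₀ a + ex⁺ H₀ b                  ≡⟨ cong (λ t → t + ex⁺ H₀ a + ex⁺ H₀ b) (exTot-sum H) ⟩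
      sum (ex⁺ H) + ex⁺ H₀ a + ex⁺ H₀ b              ≡⟨ sum-update₂ a b a≢b (λ _ → ex⁺-other) ⟩
      sum (ex⁺ H₀) + ex⁺ H a + ex⁺ H b               ≡⟨ cong₂ (λ p q → sum (ex⁺ H₀) + p + q) ex⁺-a ex⁺-b ⟩
      sum (ex⁺ H₀) + suc (ex⁺ H₀ a) + B′             ≡⟨ cong (λ t → t + suc (ex⁺ H₀ a) + B′) (exTot-sum H₀) ⟨
      exTot H₀ + suc (ex⁺ H₀ a) + B′                 ≡⟨ cong (_+ B′) (ℕ.+-suc (exTot H₀) _) ⟩
      suc (exTot H₀ + ex⁺ H₀ a + B′)                 ≡⟨ cong suc (xy∙z≈xz∙y (exTot H₀) _ _) ⟩
      suc (exTot H₀ + B′) + ex⁺ H₀ a                 ∎)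
      where
      open ≡-Reasoning
      B′ = ℕ.pred (ex⁺ H₀ b)

    exTot-preserved : indeg H₀ b < outdeg H₀ b → exTot H ≡ exTot H₀
    exTot-preserved surplus = cancel (ℕ.m<n⇒0<n∸m surplus) exTot-step
      where
      cancel : ∀ {t s e} → 0 < e → t + e ≡ suc (s + ℕ.pred e) → t ≡ s
      cancel {e = suc k} _ eq = ℕ.+-cancelʳ-≡ k _ _ (ℕ.suc-injective (trans (sym (ℕ.+-suc _ k)) eq))

    exTot-grows : ¬ indeg H₀ b < outdeg H₀ b → exTot H ≡ suc (exTot H₀)
    exTot-grows no-surplus = cancel (ℕ.m≤n⇒m∸n≡0 (ℕ.≮⇒≥ no-surplus)) exTot-step
      where
      cancel : ∀ {t s e} → e ≡ 0 → t + e ≡ suc (s + ℕ.pred e) → t ≡ suc s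
      cancel refl eq = trans (sym (ℕ.+-identityʳ _)) (trans eq (cong suc (ℕ.+-identityʳ _)))

    module PrependAt {r} (P : Fin r → Path H₀) (j : Fin r) (start≡b : start (P j) ≡ b) where

      a∉Pj : a ∉ verts (P j)
      a∉Pj a∈Pj = a≢b (trans (source∈verts⇒start (P j) source₀ a∈Pj) start≡b)

      a∷Pj : Path H
      a∷Pj = prepend a (liftPath H₀⊆H (P j)) a∉Pj (subst (λ z → H a z ≡ true) (sym start≡b) present)

      P′ : Fin r → Path H
      P′ = updateAt (liftPath H₀⊆H ∘ P) j (const a∷Pj)

      P′-j : P′ j ≡ a∷Pj
      P′-j = updateAt-updates j (liftPath H₀⊆H ∘ P)

      P′-other : ∀ {i} → i ≢ j → P′ i ≡ liftPath H₀⊆H (P i)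
      P′-other {i} i≢j = updateAt-minimal i j (liftPath H₀⊆H ∘ P) i≢j

      ∈-pedges-P′ : ∀ i {e} → e ∈ pedges (P′ i) → e ∈ pedges (P i) ⊎ (i ≡ j × e ≡ (a , b))
      ∈-pedges-P′ i {e} e∈ with i ≟ j
      ... | no  i≢j = inj₁ (subst (λ Q → e ∈ pedges Q) (P′-other i≢j) e∈)
      ... | yes refl with subst (λ Q → e ∈ pedges Q) P′-j e∈
      ...   | here e≡   = inj₂ (refl , trans e≡ (cong (a ,_) start≡b))
      ...   | there e∈Pj = inj₁ e∈Pj

      ∈-pedges-P′⁺ : ∀ i {e} → e ∈ pedges (P i) → e ∈ pedges (P′ i)
      ∈-pedges-P′⁺ i {e} e∈ with i ≟ j
      ... | no  i≢j = subst (λ Q → e ∈ pedges Q) (sym (P′-other i≢j)) e∈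
      ... | yes refl = subst (λ Q → e ∈ pedges Q) (sym P′-j) (there e∈)

      ab∈P′j : (a , b) ∈ pedges (P′ j)
      ab∈P′j = subst (λ Q → (a , b) ∈ pedges Q) (sym P′-j) (here (cong (a ,_) (sym start≡b)))

      disjoint′ : EdgeDisjoint P → EdgeDisjoint P′
      disjoint′ disjoint i k i≢k e e∈i e∈k with ∈-pedges-P′ i e∈i | ∈-pedges-P′ k e∈k
      ... | inj₁ e∈Pi       | inj₁ e∈Pk       = disjoint i k i≢k e e∈Pi e∈Pk
      ... | inj₁ e∈Pi       | inj₂ (_ , refl) = ab∉ (P i) e∈Pi
      ... | inj₂ (_ , refl) | inj₁ e∈Pk       = ab∉ (P k) e∈Pk
      ... | inj₂ (refl , _) | inj₂ (refl , _) = i≢k refl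

      extends : ExtendsBy P′ P (_≡ a)
      extends i {x} with i ≟ j
      ... | no  i≢j = (λ x∈ → subst (λ Q → x ∈ verts Q) (sym (P′-other i≢j)) x∈)
                    , (λ x∈ → inj₁ (subst (λ Q → x ∈ verts Q) (P′-other i≢j) x∈))
      ... | yes refl = (λ x∈ → subst (λ Q → x ∈ verts Q) (sym P′-j) (there x∈))
                     , (λ x∈ → split (subst (λ Q → x ∈ verts Q) P′-j x∈))
        where
        split : x ∈ verts a∷Pj → x ∈ verts (P j) ⊎ x ≡ a
        split (here x≡a)   = inj₂ x≡a
        split (there x∈Pj) = inj₁ x∈Pj

      endsAt-P′ : ∀ x → endsAt P′ x ≡ endsAt P x
      endsAt-P′ x = countFin-cong (λ i → cong (λ z → ⌊ z ≟ x ⌋) (end-P′ i))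
        where
        end-P′ : ∀ i → end (P′ i) ≡ end (P i)
        end-P′ i with i ≟ j
        ... | yes refl = cong end P′-j
        ... | no  i≢j  = cong end (P′-other i≢j)

      startsAt-P′ : ∀ x → startsAt P′ x + 𝟙 ⌊ b ≟ x ⌋ ≡ startsAt P x + 𝟙 ⌊ a ≟ x ⌋
      startsAt-P′ x = begin
        startsAt P′ x + 𝟙 ⌊ b ≟ x ⌋           ≡⟨ cong (λ z → startsAt P′ x + 𝟙 ⌊ z ≟ x ⌋) start≡b ⟨
        startsAt P′ x + 𝟙 ⌊ start (P j) ≟ x ⌋  ≡⟨ countFin-update j (λ i → cong (λ Q → ⌊ start Q ≟ x ⌋) ∘ P′-other) ⟩
        startsAt P x + 𝟙 ⌊ start (P′ j) ≟ x ⌋  ≡⟨ cong (λ Q → startsAt P x + 𝟙 ⌊ start Q ≟ x ⌋) P′-j ⟩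
        startsAt P x + 𝟙 ⌊ a ≟ x ⌋            ∎
        where open ≡-Reasoning

      startsAt-P′-a : startsAt P′ a ≡ suc (startsAt P a)
      startsAt-P′-a = begin
        startsAt P′ a                 ≡⟨ ℕ.+-identityʳ _ ⟨
        startsAt P′ a + 0             ≡⟨ cong (startsAt P′ a +_) (𝟙-≟-≢ (a≢b ∘ sym)) ⟨
        startsAt P′ a + 𝟙 ⌊ b ≟ a ⌋   ≡⟨ startsAt-P′ a ⟩
        startsAt P a + 𝟙 ⌊ a ≟ a ⌋    ≡⟨ cong (startsAt P a +_) (𝟙-≟-refl a) ⟩
        startsAt P a + 1              ≡⟨ ℕ.+-comm _ 1 ⟩
        suc (startsAt P a)            ∎
        where open ≡-Reasoning

      startsAt-P′-b : suc (startsAt P′ b) ≡ startsAt P b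
      startsAt-P′-b = begin
        suc (startsAt P′ b)           ≡⟨ ℕ.+-comm 1 _ ⟩
        startsAt P′ b + 1             ≡⟨ cong (startsAt P′ b +_) (𝟙-≟-refl b) ⟨
        startsAt P′ b + 𝟙 ⌊ b ≟ b ⌋   ≡⟨ startsAt-P′ b ⟩
        startsAt P b + 𝟙 ⌊ a ≟ b ⌋    ≡⟨ cong (startsAt P b +_) (𝟙-≟-≢ a≢b) ⟩
        startsAt P b + 0              ≡⟨ ℕ.+-identityʳ _ ⟩
        startsAt P b                  ∎
        where open ≡-Reasoning

      startsAt-P′-other : ∀ {x} → x ≢ a → x ≢ b → startsAt P′ x ≡ startsAt P x
      startsAt-P′-other {x} x≢a x≢b = ℕ.+-cancelʳ-≡ 0 _ _ (begin
        startsAt P′ x + 0             ≡⟨ cong (startsAt P′ x +_) (𝟙-≟-≢ (x≢b ∘ sym)) ⟨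
        startsAt P′ x + 𝟙 ⌊ b ≟ x ⌋   ≡⟨ startsAt-P′ x ⟩
        startsAt P x + 𝟙 ⌊ a ≟ x ⌋    ≡⟨ cong (startsAt P x +_) (𝟙-≟-≢ (x≢a ∘ sym)) ⟩
        startsAt P x + 0              ∎)
        where open ≡-Reasoning

      partial : PartialDecomp H₀ P → PartialDecomp H P′
      partial (disjoint , starts , ends) = disjoint′ disjoint , starts′ , ends′
        where
        starts′ : ∀ x → startsAt P′ x ≤ ex⁺ H x
        starts′ x with x ≟ a | x ≟ b
        ... | yes refl | _        = subst₂ _≤_ (sym startsAt-P′-a) (sym ex⁺-a) (s≤s (starts a))
        ... | no  _    | yes refl = subst (startsAt P′ b ≤_) (sym ex⁺-b)
                                      (ℕ.suc[m]≤n⇒m≤pred[n] (subst (_≤ ex⁺ H₀ b) (sym startsAt-P′-b) (starts b)))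
        ... | no  x≢a  | no  x≢b  =
          subst₂ _≤_ (sym (startsAt-P′-other x≢a x≢b)) (sym (ex⁺-other x≢a x≢b)) (starts x)
        ends′ : ∀ x → endsAt P′ x ≤ ex⁻ H x
        ends′ x = ex⁻-bound x (subst (_≤ ex⁻ H₀ x) (sym (endsAt-P′ x)) (ends x))

    extend-partial : ∀ {r} (P : Fin r → Path H₀) → PartialDecomp H₀ P →
                     Σ[ P′ ∈ (Fin r → Path H) ] PartialDecomp H P′ × ExtendsBy P′ P (_≡ a)
    extend-partial P decomp@(disjoint , starts , ends) with any? (λ i → start (P i) ≟ b)
    ... | yes (j , start≡b) = P′ , partial decomp , extends
      where open PrependAt P j start≡b
    ... | no  no-start = liftPath H₀⊆H ∘ P , (disjoint , starts′ , ends′) , λ i → id , inj₁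
      where
      starts′ : ∀ x → startsAt P x ≤ ex⁺ H x
      starts′ x with x ≟ b
      ... | yes refl = subst (_≤ ex⁺ H b) (sym no-path-at-b) z≤n
        where
        no-path-at-b : startsAt P b ≡ 0
        no-path-at-b = countFin-zero (λ i → ⌊⌋≡false (start (P i) ≟ b) (no-start ∘ (i ,_)))
      ... | no  x≢b  = ℕ.≤-trans (starts x) (ex⁺-mono x≢b)
      ends′ : ∀ x → endsAt P x ≤ ex⁻ H x
      ends′ x = ex⁻-bound x (ends x)

    extend-perfect : HasPerfectDecomp H₀ → HasPerfectDecomp H
    extend-perfect (P , disjoint , covers) with indeg H₀ b ℕ.<? outdeg H₀ b
    ... | yes surplus with surplus⇒start P disjoint covers surplus
    ...   | j , start≡b = mkPerfectDecomp (sym (exTot-preserved surplus)) P′ (disjoint′ disjoint) covers′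
      where
      open PrependAt P j start≡b
      covers′ : Covers P′
      covers′ (x , y) xy∈H with new-or-old xy∈H
      ... | inj₁ refl  = j , ab∈P′j
      ... | inj₂ xy∈H₀ = let i , xy∈Pi = covers (x , y) xy∈H₀ in i , ∈-pedges-P′⁺ i xy∈Pi
    extend-perfect (P , disjoint , covers) | no no-surplus =
      mkPerfectDecomp (sym (exTot-grows no-surplus)) P″ disjoint″ covers″
      where
      P″ : Fin (suc (exTot H₀)) → Path H
      P″ zero    = edgePath a≢b present
      P″ (suc i) = liftPath H₀⊆H (P i)
      disjoint″ : EdgeDisjoint P″
      disjoint″ zero    zero    0≢0 = ⊥-elim (0≢0 refl)
      disjoint″ zero    (suc k) _   e (here refl) e∈Pk        = ab∉ (P k) e∈Pk
      disjoint″ (suc i) zero    _   e e∈Pi        (here refl) = ab∉ (P i) e∈Pi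
      disjoint″ (suc i) (suc k) i≢k = disjoint i k (i≢k ∘ cong suc)
      covers″ : Covers P″
      covers″ (x , y) xy∈H with new-or-old xy∈H
      ... | inj₁ refl  = zero , here refl
      ... | inj₂ xy∈H₀ = let i , xy∈Pi = covers (x , y) xy∈H₀ in suc i , xy∈Pi

  module _ {n : ℕ} {G H : Digraph n} (G≐H : G ≐ H) where

    ≐⇒⊆ : G ⊆ H
    ≐⇒⊆ {x} {y} xy = trans (sym (G≐H x y)) xy

    path-≐ : Path G → Path H
    path-≐ = liftPath ≐⇒⊆

    ex⁺-≐ : ∀ x → ex⁺ G x ≡ ex⁺ H x
    ex⁺-≐ x = cong₂ _∸_ (countFin-cong (G≐H x)) (countFin-cong (λ w → G≐H w x))

    ex⁻-≐ : ∀ x → ex⁻ G x ≡ ex⁻ H x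
    ex⁻-≐ x = cong₂ _∸_ (countFin-cong (λ w → G≐H w x)) (countFin-cong (G≐H x))

    exTot-≐ : exTot G ≡ exTot H
    exTot-≐ = trans (exTot-sum G) (trans (sum-cong-≗ ex⁺-≐) (sym (exTot-sum H)))

    partial-≐ : ∀ {r} {P : Fin r → Path G} → PartialDecomp G P → PartialDecomp H (path-≐ ∘ P)
    partial-≐ {P = P} (disjoint , starts , ends) =
      disjoint
      , (λ x → subst (startsAt P x ≤_) (ex⁺-≐ x) (starts x))
      , (λ x → subst (endsAt P x ≤_) (ex⁻-≐ x) (ends x))

    perfect-≐ : HasPerfectDecomp G → HasPerfectDecomp H
    perfect-≐ (P , disjoint , covers) =
      mkPerfectDecomp exTot-≐ (path-≐ ∘ P) disjoint (λ (x , y) xy∈H → covers (x , y) (trans (G≐H x y) xy∈H))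

  ExtendsBy-trans : ∀ {n} {G H K : Digraph n} {r} {P : Fin r → Path G} {P′ : Fin r → Path H} {P″ : Fin r → Path K}
                    {Z Z′ : Fin n → Set} → ExtendsBy P′ P Z → ExtendsBy P″ P′ Z′ → (∀ {x} → Z′ x → Z x) →
                    ExtendsBy P″ P Z
  ExtendsBy-trans ext ext′ Z′⇒Z i =
    proj₁ (ext′ i) ∘ proj₁ (ext i) ,
    λ x∈P″ → [ proj₂ (ext i) , inj₂ ∘ Z′⇒Z ] (proj₂ (ext′ i) x∈P″)

  module SourceExtension {n} {H H′ : Digraph n} (H⊆H′ : H ⊆ H′) (S : Fin n → Set)
    (new⇒S : ∀ {a b} → H′ a b ≡ true → H a b ≡ false → S a)
    (S-source : ∀ {a} → S a → ∀ x → H′ x a ≡ false) where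

    H+ : List (Edge n) → Digraph n
    H+ []      = H
    H+ (e ∷ L) x y = (⌊ (x , y) ≟ᴱ e ⌋ ∧ H′ x y) ∨ H+ L x y

    H⊆H+ : ∀ L → H ⊆ H+ L
    H⊆H+ []      xy = xy
    H⊆H+ (e ∷ L) {x} {y} xy = trans (cong (_ ∨_) (H⊆H+ L xy)) (∨-zeroʳ _)

    H+⊆H′ : ∀ L → H+ L ⊆ H′
    H+⊆H′ []      xy = H⊆H′ xy
    H+⊆H′ (e ∷ L) {x} {y} xy with (x , y) ≟ᴱ e
    ... | no  _ = H+⊆H′ L xy
    ... | yes _ with H′ x y in h′
    ...   | true  = refl
    ...   | false = trans (sym h′) (H+⊆H′ L xy)

    H+-complete : ∀ L {x y} → (x , y) ∈ L → H′ x y ≡ true → H+ L x y ≡ true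
    H+-complete (e ∷ L) {x} {y} xy∈L h′ with (x , y) ≟ᴱ e
    ... | yes _ rewrite h′ = refl
    ... | no xy≢e with xy∈L
    ...   | here xy≡e  = ⊥-elim (xy≢e xy≡e)
    ...   | there xy∈L′ = H+-complete L xy∈L′ h′

    allEdges : List (Edge n)
    allEdges = cartesianProduct (allFin n) (allFin n)

    H+-allEdges : H+ allEdges ≐ H′
    H+-allEdges x y with H′ x y in h′ | H+ allEdges x y in g
    ... | true  | true  = refl
    ... | false | false = refl
    ... | true  | false = trans (sym g) (H+-complete allEdges (∈-cartesianProduct⁺ (∈-allFin x) (∈-allFin y)) h′)
    ... | false | true  = trans (sym (H+⊆H′ allEdges g)) h′

    unchanged : ∀ e L → H′ (proj₁ e) (proj₂ e) ≡ false ⊎ H+ L (proj₁ e) (proj₂ e) ≡ true →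
                H+ L ≐ H+ (e ∷ L)
    unchanged e L redundant x y with (x , y) ≟ᴱ e
    ... | no  _    = refl
    ... | yes refl with redundant
    ...   | inj₁ h′ rewrite h′ = refl
    ...   | inj₂ g  rewrite g  = sym (∨-zeroʳ _)

    H+-absent⇒H-absent : ∀ L {a b} → H+ L a b ≡ false → H a b ≡ false
    H+-absent⇒H-absent L {a} {b} g with H a b in h
    ... | false = refl
    ... | true  with () ← trans (sym g) (H⊆H+ L h)

    new-in-H+⇒S : ∀ L {a b} → H′ a b ≡ true → H+ L a b ≡ false → S a
    new-in-H+⇒S L h′ g = new⇒S h′ (H+-absent⇒H-absent L g)

    added : ∀ a b L → H′ a b ≡ true → H+ L a b ≡ false → SourceEdgeAddition (H+ L) a b (H+ ((a , b) ∷ L))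
    added a b L h′ g = record
      { absent  = g
      ; present = present
      ; agree   = agree
      ; source  = source
      }
      where
      present : H+ ((a , b) ∷ L) a b ≡ true
      present rewrite ⌊⌋≡true ((a , b) ≟ᴱ (a , b)) refl | h′ = refl
      agree : ∀ {x y} → (x , y) ≢ (a , b) → H+ ((a , b) ∷ L) x y ≡ H+ L x y
      agree {x} {y} xy≢ab rewrite ⌊⌋≡false ((x , y) ≟ᴱ (a , b)) xy≢ab = refl
      source : ∀ x → H+ ((a , b) ∷ L) x a ≡ false
      source x with H+ ((a , b) ∷ L) x a in xa
      ... | false = refl
      ... | true  with () ← trans (sym (S-source (new-in-H+⇒S L h′ g) x)) (H+⊆H′ ((a , b) ∷ L) xa)

    data Growth (a b : Fin n) (L : List (Edge n)) : Set where
      same : H+ L ≐ H+ ((a , b) ∷ L) → Growth a b L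
      new  : SourceEdgeAddition (H+ L) a b (H+ ((a , b) ∷ L)) → S a → Growth a b L

    growth : ∀ a b L → Growth a b L
    growth a b L with H′ a b in h′ | H+ L a b in g
    ... | false | _     = same (unchanged (a , b) L (inj₁ h′))
    ... | true  | true  = same (unchanged (a , b) L (inj₂ g))
    ... | true  | false = new (added a b L h′ g) (new-in-H+⇒S L h′ g)

    extend-partial-upto : ∀ L {r} (P : Fin r → Path H) → PartialDecomp H P →
                          Σ[ P′ ∈ (Fin r → Path (H+ L)) ] PartialDecomp (H+ L) P′ × ExtendsBy P′ P S
    extend-partial-upto []            P decomp = P , decomp , λ i → id , inj₁
    extend-partial-upto ((a , b) ∷ L) P decomp with extend-partial-upto L P decomp | growth a b L
    ... | P′ , decomp′ , ext | same H+≐ = path-≐ H+≐ ∘ P′ , partial-≐ H+≐ {P = P′} decomp′ , ext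
    ... | P′ , decomp′ , ext | new add Sa with SourceEdgeStep.extend-partial add P′ decomp′
    ...   | P″ , decomp″ , ext′ =
      P″ , decomp″ , ExtendsBy-trans {P = P} {P′ = P′} {P″ = P″} {Z = S} {Z′ = _≡ a} ext ext′ λ { refl → Sa }

    extend-perfect-upto : ∀ L → HasPerfectDecomp H → HasPerfectDecomp (H+ L)
    extend-perfect-upto []            decomp = decomp
    extend-perfect-upto ((a , b) ∷ L) decomp with growth a b L
    ... | same H+≐  = perfect-≐ H+≐ (extend-perfect-upto L decomp)
    ... | new add _ = SourceEdgeStep.extend-perfect add (extend-perfect-upto L decomp)

    NoDeficitAtNewHeads : Set
    NoDeficitAtNewHeads = ∀ {a b} → H′ a b ≡ true → H a b ≡ false → indeg H′ b ≤ outdeg H′ b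

    exTot-upto : NoDeficitAtNewHeads → ∀ L → exTot (H+ L) ≡ exTot H
    exTot-upto no-deficit []            = refl
    exTot-upto no-deficit ((a , b) ∷ L) with growth a b L
    ... | same H+≐   = trans (sym (exTot-≐ H+≐)) (exTot-upto no-deficit L)
    ... | new add _ = trans (SourceEdgeStep.exTot-preserved add surplus) (exTot-upto no-deficit L)
      where
      open SourceEdgeAddition add
      ab∈H′ : H′ a b ≡ true
      ab∈H′ = H+⊆H′ ((a , b) ∷ L) present
      out-of-b : ∀ w → H′ b w ≡ true → H+ L b w ≡ true
      out-of-b w bw with H b w in h
      ... | true  = H⊆H+ L h
      ... | false with () ← trans (sym (S-source (new⇒S bw h) a)) ab∈H′
      surplus : indeg (H+ L) b < outdeg (H+ L) b
      surplus = begin-strict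
        indeg (H+ L) b   <⟨ countFin-mono-< (λ _ → H+⊆H′ L) a absent ab∈H′ ⟩
        indeg H′ b      ≤⟨ no-deficit ab∈H′ (H+-absent⇒H-absent L absent) ⟩
        outdeg H′ b     ≤⟨ countFin-mono out-of-b ⟩
        outdeg (H+ L) b  ∎
        where open ℕ.≤-Reasoning

    extend-partial : ∀ {r} (P : Fin r → Path H) → PartialDecomp H P →
                     Σ[ P′ ∈ (Fin r → Path H′) ] PartialDecomp H′ P′ × ExtendsBy P′ P S
    extend-partial P decomp with extend-partial-upto allEdges P decomp
    ... | P′ , decomp′ , ext = path-≐ H+-allEdges ∘ P′ , partial-≐ H+-allEdges {P = P′} decomp′ , ext

    extend-perfect : HasPerfectDecomp H → HasPerfectDecomp H′
    extend-perfect = perfect-≐ H+-allEdges ∘ extend-perfect-upto allEdges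

    exTot-extension : NoDeficitAtNewHeads → exTot H′ ≡ exTot H
    exTot-extension no-deficit = trans (sym (exTot-≐ H+-allEdges)) (exTot-upto no-deficit allEdges)

  m∸n+n≡n∸m+m : ∀ m n → m ∸ n + n ≡ n ∸ m + m
  m∸n+n≡n∸m+m m n with ℕ.≤-total n m
  ... | inj₁ n≤m rewrite ℕ.m≤n⇒m∸n≡0 n≤m = ℕ.m∸n+n≡m n≤m
  ... | inj₂ m≤n rewrite ℕ.m≤n⇒m∸n≡0 m≤n = sym (ℕ.m∸n+n≡m m≤n)

  module _ {n : ℕ} {H : Digraph n} where

    exTot-flip : exTot (flip H) ≡ exTot H
    exTot-flip = begin
      exTot (flip H)  ≡⟨ exTot-sum (flip H) ⟩
      sum (ex⁻ H)     ≡⟨ ℕ.+-cancelʳ-≡ (sum (outdeg H)) _ _ excess-balance ⟩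
      sum (ex⁺ H)     ≡⟨ exTot-sum H ⟨
      exTot H         ∎
      where
      open ≡-Reasoning
      handshake : sum (outdeg H) ≡ sum (indeg H)
      handshake = countFin-comm H
      excess-balance : sum (ex⁻ H) + sum (outdeg H) ≡ sum (ex⁺ H) + sum (outdeg H)
      excess-balance = begin
        sum (ex⁻ H) + sum (outdeg H)               ≡⟨ ∑-distrib-+ (ex⁻ H) (outdeg H) ⟨
        sum (λ v → ex⁻ H v + outdeg H v)           ≡⟨ sum-cong-≗ (λ v → m∸n+n≡n∸m+m (indeg H v) (outdeg H v)) ⟩
        sum (λ v → ex⁺ H v + indeg H v)            ≡⟨ ∑-distrib-+ (ex⁺ H) (indeg H) ⟩
        sum (ex⁺ H) + sum (indeg H)                ≡⟨ cong (sum (ex⁺ H) +_) handshake ⟨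
        sum (ex⁺ H) + sum (outdeg H)               ∎

    reverse-disjoint : ∀ {r} {P : Fin r → Path H} → EdgeDisjoint P → EdgeDisjoint (reversePath ∘ P)
    reverse-disjoint {P = P} disjoint i j i≢j (x , y) xy∈i xy∈j = disjoint i j i≢j (y , x)
      (Equivalence.to (∈-pedges-reversePath (P i)) xy∈i) (Equivalence.to (∈-pedges-reversePath (P j)) xy∈j)

    reverse-partial : ∀ {r} {P : Fin r → Path H} → PartialDecomp H P → PartialDecomp (flip H) (reversePath ∘ P)
    reverse-partial {P = P} (disjoint , starts , ends) = reverse-disjoint {P = P} disjoint , starts′ , ends′
      where
      starts′ : ∀ x → startsAt (reversePath ∘ P) x ≤ ex⁺ (flip H) x
      starts′ x = subst (_≤ ex⁻ H x) (countFin-cong (λ i → cong (λ z → ⌊ z ≟ x ⌋) (sym (reversePath-start (P i)))))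
                    (ends x)
      ends′ : ∀ x → endsAt (reversePath ∘ P) x ≤ ex⁻ (flip H) x
      ends′ x = subst (_≤ ex⁺ H x) (countFin-cong (λ i → cong (λ z → ⌊ z ≟ x ⌋) (sym (reversePath-end (P i)))))
                  (starts x)

    reverse-perfect : HasPerfectDecomp H → HasPerfectDecomp (flip H)
    reverse-perfect (P , disjoint , covers) =
      mkPerfectDecomp (sym exTot-flip) (reversePath ∘ P) (reverse-disjoint {P = P} disjoint) covers′
      where
      covers′ : Covers (reversePath ∘ P)
      covers′ (x , y) yx∈H = let i , yx∈Pi = covers (y , x) yx∈H
                             in i , Equivalence.from (∈-pedges-reversePath (P i)) yx∈Pi

  module _ {n : ℕ} {H : Digraph n} where

    -- A path consisting of a single vertex x is allowed, but it forces ex⁺ x > 0.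
    partial-vertex-incident : ∀ {r} {P : Fin r → Path H} → PartialDecomp H P →
                              ∀ i {x} → x ∈ verts (P i) → ∃[ y ] (H y x ≡ true ⊎ H x y ≡ true)
    partial-vertex-incident {P = P} (_ , starts , _) i {x} x∈Pi with x ≟ start (P i)
    ... | no  x≢start = let y , yx∈Pi = predecessor (P i) x∈Pi x≢start
                        in y , inj₁ (∈-pedges⇒IsEdge (P i) yx∈Pi)
    ... | yes refl    = let y , xy = countFin-pos (H x) 0<outdeg in y , inj₂ xy
      where
      0<outdeg : 0 < outdeg H x
      0<outdeg = ℕ.≤-trans (countFin-witness (λ k → ⌊ start (P k) ≟ x ⌋) i (⌊⌋≡true (x ≟ x) refl))
                   (ℕ.≤-trans (starts x) (ℕ.m∸n≤m (outdeg H x) (indeg H x)))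

  0≤ex⇒indeg≤outdeg : ∀ {n} {H : Digraph n} {v} → ℤ.0ℤ ℤ.≤ ex H v → indeg H v ≤ outdeg H v
  0≤ex⇒indeg≤outdeg = ℤ.drop‿+≤+ ∘ ℤ.0≤i-j⇒j≤i

  ex≤0⇒outdeg≤indeg : ∀ {n} {H : Digraph n} {v} → ex H v ℤ.≤ ℤ.0ℤ → outdeg H v ≤ indeg H v
  ex≤0⇒outdeg≤indeg = ℤ.drop‿+≤+ ∘ ℤ.i-j≤0⇒i≤j

  ∧-elimˡ : ∀ {x y} → x ∧ y ≡ true → x ≡ true
  ∧-elimˡ {true} _ = refl

  ∧-elimʳ : ∀ {x y} → x ∧ y ≡ true → y ≡ true
  ∧-elimʳ {true} y≡true = y≡true

  isR⇒Rpart : ∀ {p} → isR p ≡ true → p ≡ Rpart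
  isR⇒Rpart {Rpart} _ = refl

  module Partitioned {n} (D : Digraph n) (part : Fin n → Part)
    (R↛A⁺ : (u v : Fin n) → part u ≡ Rpart → part v ≡ Aplus → D u v ≡ true → ⊥)
    (A⁻↛R : (u v : Fin n) → part u ≡ Aminus → part v ≡ Rpart → D u v ≡ true → ⊥)
    (A↛A : (u v : Fin n) → isR (part u) ≡ false → isR (part v) ≡ false → D u v ≡ true → ⊥) where

    D[R] : Digraph n
    D[R] = inducedR D part

    D[→R] : Digraph n
    D[→R] u v = isR (part v) ∧ D u v

    D[R]⊆D[→R] : D[R] ⊆ D[→R]
    D[R]⊆D[→R] {x} = ∧-elimʳ {isR (part x)}

    D[→R]⊆D : D[→R] ⊆ D
    D[→R]⊆D {y = y} = ∧-elimʳ {isR (part y)}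

    new-edge-from-A⁺ : ∀ {a b} → D[→R] a b ≡ true → D[R] a b ≡ false → part a ≡ Aplus
    new-edge-from-A⁺ {a} {b} ab new with part a in pa
    ... | Aplus  = refl
    ... | Aminus = ⊥-elim (A⁻↛R a b pa (isR⇒Rpart (∧-elimˡ ab)) (D[→R]⊆D ab))
    ... | Rpart  with () ← trans (sym new) ab

    A⁺-source : ∀ {a} → part a ≡ Aplus → ∀ x → D[→R] x a ≡ false
    A⁺-source pa x rewrite pa = refl

    new-edge-into-A⁻ : ∀ {a b} → D b a ≡ true → D[→R] b a ≡ false → part a ≡ Aminus
    new-edge-into-A⁻ {a} {b} ba new with part a in pa
    ... | Aminus = refl
    ... | Rpart  with () ← trans (sym new) ba
    ... | Aplus  with part b in pb
    ...   | Rpart  = ⊥-elim (R↛A⁺ b a pb pa ba)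
    ...   | Aplus  = ⊥-elim (A↛A b a (cong isR pb) (cong isR pa) ba)
    ...   | Aminus = ⊥-elim (A↛A b a (cong isR pb) (cong isR pa) ba)

    A⁻-sink : ∀ {a} → part a ≡ Aminus → ∀ x → D a x ≡ false
    A⁻-sink {a} pa x with D a x in ax
    ... | false = refl
    ... | true with part x in px
    ...   | Rpart  = ⊥-elim (A⁻↛R a x pa px ax)
    ...   | Aplus  = ⊥-elim (A↛A a x (cong isR pa) (cong isR px) ax)
    ...   | Aminus = ⊥-elim (A↛A a x (cong isR pa) (cong isR px) ax)

    module IntoR  = SourceExtension D[R]⊆D[→R] (λ v → part v ≡ Aplus) new-edge-from-A⁺ A⁺-source
    module IntoA⁻ = SourceExtension {H = flip D[→R]} {H′ = flip D} D[→R]⊆D (λ v → part v ≡ Aminus)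
                                    new-edge-into-A⁻ A⁻-sink

    vertex∈R : ∀ {r} {P : Fin r → Path D[R]} → PartialDecomp D[R] P →
               ∀ i {x} → x ∈ verts (P i) → part x ≡ Rpart
    vertex∈R {P = P} decomp i x∈Pi with partial-vertex-incident {P = P} decomp i x∈Pi
    ... | y , inj₁ yx = isR⇒Rpart (∧-elimˡ (D[R]⊆D[→R] yx))
    ... | y , inj₂ xy = isR⇒Rpart (∧-elimˡ xy)

    extend-partial : ∀ r (P : Fin r → Path D[R]) → PartialDecomp D[R] P →
                     Σ (Fin r → Path D) λ P′ → PartialDecomp D P′
                       × ((i : Fin r) (v : Fin n) → ((v ∈ verts (P′ i) × part v ≡ Rpart) ⇔ v ∈ verts (P i)))
    extend-partial r P decomp with IntoR.extend-partial P decomp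
    ... | P₁ , decomp₁ , ext₁ with IntoA⁻.extend-partial (reversePath ∘ P₁) (reverse-partial {P = P₁} decomp₁)
    ... | P₂ , decomp₂ , ext₂ = reversePath ∘ P₂ , reverse-partial {P = P₂} decomp₂ , λ i v → mk⇔ (to i) (from i)
      where
      to : ∀ i {v} → v ∈ verts (reversePath (P₂ i)) × part v ≡ Rpart → v ∈ verts (P i)
      to i (v∈P′ , v∈R) with proj₂ (ext₂ i) (Equivalence.to (∈-verts-reversePath (P₂ i)) v∈P′)
      ... | inj₂ v∈A⁻ with () ← trans (sym v∈A⁻) v∈R
      ... | inj₁ v∈P₁ with proj₂ (ext₁ i) (Equivalence.to (∈-verts-reversePath (P₁ i)) v∈P₁)
      ...   | inj₁ v∈P  = v∈P
      ...   | inj₂ v∈A⁺ with () ← trans (sym v∈A⁺) v∈R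
      from : ∀ i {v} → v ∈ verts (P i) → v ∈ verts (reversePath (P₂ i)) × part v ≡ Rpart
      from i v∈P = Equivalence.from (∈-verts-reversePath (P₂ i))
                     (proj₁ (ext₂ i) (Equivalence.from (∈-verts-reversePath (P₁ i)) (proj₁ (ext₁ i) v∈P)))
                 , vertex∈R {P = P} decomp i v∈P

    extend-perfect : HasPerfectDecomp D[R] → HasPerfectDecomp D
    extend-perfect = reverse-perfect ∘ IntoA⁻.extend-perfect ∘ reverse-perfect ∘ IntoR.extend-perfect

    no-deficit-into-R : ((v a : Fin n) → part a ≡ Aplus → D a v ≡ true → ℤ.0ℤ ℤ.≤ ex D v) →
                        ((v a b : Fin n) → part a ≡ Aplus → D a v ≡ true → part b ≡ Aminus → D v b ≡ true → ⊥) →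
                        IntoR.NoDeficitAtNewHeads
    no-deficit-into-R A⁺-heads no-A⁺→v→A⁻ {a} {b} ab new = begin
      indeg D[→R] b    ≤⟨ countFin-mono {p = λ w → D[→R] w b} (λ _ → D[→R]⊆D) ⟩
      indeg D b        ≤⟨ 0≤ex⇒indeg≤outdeg {H = D} (A⁺-heads b a a∈A⁺ (D[→R]⊆D ab)) ⟩
      outdeg D b       ≤⟨ countFin-mono into-R ⟩
      outdeg D[→R] b   ∎
      where
      open ℕ.≤-Reasoning
      a∈A⁺ = new-edge-from-A⁺ ab new
      into-R : ∀ w → D b w ≡ true → D[→R] b w ≡ true
      into-R w bw with part w in pw
      ... | Rpart  = bw
      ... | Aplus  = ⊥-elim (R↛A⁺ b w (isR⇒Rpart (∧-elimˡ ab)) pw bw)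
      ... | Aminus = ⊥-elim (no-A⁺→v→A⁻ b a w a∈A⁺ (D[→R]⊆D ab) pw bw)

    no-deficit-into-A⁻ : ((v b : Fin n) → part b ≡ Aminus → D v b ≡ true → ex D v ℤ.≤ ℤ.0ℤ) →
                         IntoA⁻.NoDeficitAtNewHeads
    no-deficit-into-A⁻ A⁻-tails {a} {b} ba new =
      ex≤0⇒outdeg≤indeg {H = D} (A⁻-tails b a (new-edge-into-A⁻ ba new) ba)

    exTot-D[R]≡exTot-D : ((v a : Fin n) → part a ≡ Aplus → D a v ≡ true → ℤ.0ℤ ℤ.≤ ex D v) →
                         ((v b : Fin n) → part b ≡ Aminus → D v b ≡ true → ex D v ℤ.≤ ℤ.0ℤ) →
                         ((v a b : Fin n) → part a ≡ Aplus → D a v ≡ true → part b ≡ Aminus → D v b ≡ true → ⊥) →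
                         exTot D[R] ≡ exTot D
    exTot-D[R]≡exTot-D A⁺-heads A⁻-tails no-A⁺→v→A⁻ = begin
      exTot D[R]           ≡⟨ IntoR.exTot-extension (no-deficit-into-R A⁺-heads no-A⁺→v→A⁻) ⟨
      exTot D[→R]          ≡⟨ exTot-flip {H = D[→R]} ⟨
      exTot (flip D[→R])   ≡⟨ IntoA⁻.exTot-extension (no-deficit-into-A⁻ A⁻-tails) ⟨
      exTot (flip D)       ≡⟨ exTot-flip {H = D} ⟩
      exTot D              ∎
      where open ≡-Reasoning

open import Defs
open import Data.Nat using (ℕ)
open import Data.Integer using (+_; _≤_)
open import Data.Fin using (Fin)
open import Data.Bool using (true; false)
open import Data.Product using (_×_; Σ; _,_)
open import Data.Empty using (⊥)
open import Data.List.Membership.Propositional using (_∈_)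
open import Relation.Binary.PropositionalEquality using (_≡_)
open import Function.Bundles using (_⇔_)
open PathDecompositions using (module Partitioned)

proposition4p2 : ∀ {n} (D : Digraph n) → Loopless D → (part : Fin n → Part)
  → ((u v : Fin n) → part u ≡ Rpart → part v ≡ Aplus → D u v ≡ true → ⊥)
  → ((u v : Fin n) → part u ≡ Aminus → part v ≡ Rpart → D u v ≡ true → ⊥)
  → ((u v : Fin n) → isR (part u) ≡ false → isR (part v) ≡ false → D u v ≡ true → ⊥)
  → (((r : ℕ) (P : Fin r → Path (inducedR D part)) → PartialDecomp (inducedR D part) P
        → Σ (Fin r → Path D) λ P′ → PartialDecomp D P′
            × ((i : Fin r) (v : Fin n) → ((v ∈ verts (P′ i) × part v ≡ Rpart) ⇔ v ∈ verts (P i))))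
     × (HasPerfectDecomp (inducedR D part) → HasPerfectDecomp D)
     × (((v a : Fin n) → part a ≡ Aplus → D a v ≡ true → + 0 ≤ ex D v)
        → ((v b : Fin n) → part b ≡ Aminus → D v b ≡ true → ex D v ≤ + 0)
        → ((v a b : Fin n) → part a ≡ Aplus → D a v ≡ true → part b ≡ Aminus → D v b ≡ true → ⊥)
        → exTot (inducedR D part) ≡ exTot D))
proposition4p2 D _ part R↛A⁺ A⁻↛R A↛A = extend-partial , extend-perfect , exTot-D[R]≡exTot-D
  where open Partitioned D part R↛A⁺ A⁻↛R A↛A
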